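{- Let $n\ge 4$ and let $C_n$ be the cycle of order $n$. Then $$\gamma_{\times 2,t}^{r}(C_n\overline{C_n})=\begin{cases} 2n & \text{if } n=4,5,\\ n+2 & \text{if } n\ge 6.\end{cases}$$
   Context: All graphs are finite and simple; $N(x)$ denotes the open neighborhood of $x$. For an integer $k\ge 1$, a set $S\subseteq V(H)$ is a $k$-tuple total dominating set of $H$ if $|N(x)\cap S|\ge k$ for every $x\in V(H)$. It is a $k$-tuple total restrained dominating set (kTRDS) if moreover every vertex $x\in V(H)\setminus S$ is adjacent to at least $k$ vertices of $V(H)\setminus S$; $\gamma_{\times k,t}^{r}(H)$ is the minimum cardinality of a kTRDS of $H$. The complementary prism $G\overline{G}$ of a graph $G$ is the graph formed from the disjoint union of $G$ and its complement $\overline{G}$ by adding a perfect matching joining each vertex of $G$ to its copy in $\overline{G}$. -}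

module Defs where

open import Data.Nat using (ℕ; zero; suc; _+_; _∸_; _≤_; _≡ᵇ_)
open import Data.Bool using (Bool; true; false; not; _∧_; _∨_)
open import Data.Bool.Properties using (∨-comm; ∧-zeroʳ)
open import Data.Empty using (⊥-elim)
open import Relation.Nullary using (yes; no)
open import Data.Fin using (Fin; toℕ; splitAt)
open import Data.Fin.Properties using () renaming (_≟_ to _≟ᶠ_)
open import Data.Fin.Subset using (Subset; _∩_; ∁; ∣_∣; _∈_; _∉_)
open import Data.Vec using (tabulate)
open import Data.Sum using (inj₁; inj₂)
open import Data.Product using (Σ; _×_)
open import Relation.Binary.PropositionalEquality using (_≡_; refl; sym; trans; cong; cong₂)
open import Relation.Nullary.Decidable using (⌊_⌋)

record Graph (m : ℕ) : Set where
  field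
    adj     : Fin m → Fin m → Bool
    adj-sym : ∀ i j → adj i j ≡ adj j i
    adj-irr : ∀ i → adj i i ≡ false
open Graph public

N : ∀ {m} → Graph m → Fin m → Subset m
N G x = tabulate (adj G x)

IsKTRDS : ∀ {m} → Graph m → ℕ → Subset m → Set
IsKTRDS G k S =
  (∀ x → k ≤ ∣ N G x ∩ S ∣) ×
  (∀ x → x ∉ S → k ≤ ∣ N G x ∩ ∁ S ∣)

γ×t-r≡ : ∀ {m} → Graph m → ℕ → ℕ → Set
γ×t-r≡ G k v =
  Σ (Subset _) (λ S → IsKTRDS G k S × ∣ S ∣ ≡ v) ×
  (∀ S → IsKTRDS G k S → v ≤ ∣ S ∣)

cycleAdj : (n : ℕ) → Fin n → Fin n → Bool
cycleAdj n i j = step i j ∨ step j i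
  where
  step : Fin n → Fin n → Bool
  step a b = (toℕ b ≡ᵇ suc (toℕ a)) ∨ ((toℕ a ≡ᵇ n ∸ 1) ∧ (toℕ b ≡ᵇ 0))

private
  eqᶠ : ∀ {m} → Fin m → Fin m → Bool
  eqᶠ i j = ⌊ i ≟ᶠ j ⌋

  eqᶠ-sym : ∀ {m} (i j : Fin m) → eqᶠ i j ≡ eqᶠ j i
  eqᶠ-sym i j with i ≟ᶠ j | j ≟ᶠ i
  ... | yes _ | yes _ = refl
  ... | no _  | no _  = refl
  ... | yes p | no ¬q = ⊥-elim (¬q (sym p))
  ... | no ¬p | yes q = ⊥-elim (¬p (sym q))

  eqᶠ-refl : ∀ {m} (i : Fin m) → eqᶠ i i ≡ true
  eqᶠ-refl i with i ≟ᶠ i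
  ... | yes _ = refl
  ... | no ¬p = ⊥-elim (¬p refl)

cycle : (n : ℕ) → Graph n
cycle n = record
  { adj     = λ i j → cycleAdj n i j ∧ not (eqᶠ i j)
  ; adj-sym = λ i j → cong₂ _∧_ (∨-comm (step i j) (step j i)) (cong not (eqᶠ-sym i j))
  ; adj-irr = λ i → trans (cong (λ b → cycleAdj n i i ∧ not b) (eqᶠ-refl i)) (∧-zeroʳ _)
  }
  where
  step : Fin n → Fin n → Bool
  step a b = (toℕ b ≡ᵇ suc (toℕ a)) ∨ ((toℕ a ≡ᵇ n ∸ 1) ∧ (toℕ b ≡ᵇ 0))

complement : ∀ {m} → Graph m → Graph m
complement G = record
  { adj     = λ i j → not (adj G i j) ∧ not (eqᶠ i j)
  ; adj-sym = λ i j → cong₂ _∧_ (cong not (adj-sym G i j)) (cong not (eqᶠ-sym i j))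
  ; adj-irr = λ i → trans (cong (λ b → not (adj G i i) ∧ not b) (eqᶠ-refl i)) (∧-zeroʳ _)
  }

-- Complementary prism G Ḡ on Fin (m + m): the first m vertices carry G,
-- the last m carry its complement, and vertex i of G is matched with
-- its copy i of Ḡ.
prismAdj : ∀ {m} → Graph m → Fin (m + m) → Fin (m + m) → Bool
prismAdj {m} G u v with splitAt m u | splitAt m v
... | inj₁ a | inj₁ b = adj G a b
... | inj₂ a | inj₂ b = adj (complement G) a b
... | inj₁ a | inj₂ b = eqᶠ a b
... | inj₂ a | inj₁ b = eqᶠ a b

complementaryPrism : ∀ {m} → Graph m → Graph (m + m)
complementaryPrism {m} G = record
  { adj     = prismAdj G
  ; adj-sym = sym′
  ; adj-irr = irr
  }
  where
  sym′ : ∀ u v → prismAdj G u v ≡ prismAdj G v u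
  sym′ u v with splitAt m u | splitAt m v
  ... | inj₁ a | inj₁ b = adj-sym G a b
  ... | inj₂ a | inj₂ b = adj-sym (complement G) a b
  ... | inj₁ a | inj₂ b = eqᶠ-sym a b
  ... | inj₂ a | inj₁ b = eqᶠ-sym a b
  irr : ∀ u → prismAdj G u u ≡ false
  irr u with splitAt m u
  ... | inj₁ a = adj-irr G a
  ... | inj₂ a = adj-irr (complement G) a

-- A vertex outside a 2-tuple total restrained dominating set S needs two neighbours in S and
-- two outside, so its degree is at least 4. In the complementary prism of C_n every vertex of
-- the C_n-copy has degree 3 and so lies in S; a vertex of the complement copy has only one
-- neighbour in the C_n-copy, so it has a neighbour in S inside the complement copy, and
-- following such neighbours twice yields two vertices of S there: |S| ≥ n + 2. For n = 4, 5
-- the complement vertices have degree at most 3 as well, forcing S to be everything. For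
-- n ≥ 6 the C_n-copy together with the copies of the vertices 0 and 3 works: the closed
-- neighbourhoods of 0 and 3 in C_n are disjoint, and any other vertex of the complement
-- copy is non-adjacent in C_n to two vertices among 1, 2, 4, 5.

module Submission where

open import Defs
open import Data.Nat using (ℕ; zero; suc; _+_; _*_; _∸_; _≤_; _<_; s≤s; s≤s⁻¹; _≡ᵇ_; _≤?_; _<?_)
open import Data.Nat.Properties
  using (+-suc; +-comm; +-mono-≤; +-monoˡ-≤; +-monoʳ-≤; ≤-trans; ≤-reflexive; ≤-antisym; <⇒≤; <⇒≱; ≰⇒>; ≮⇒≥;
         ≤∧≢⇒<; 1+n≰n; n≮n; n≢0⇒n>0; m≤m+n; m≤n+m; m≤n⇒m≤1+n; m+n≤o⇒n≤o; ≡ᵇ⇒≡; ≡⇒≡ᵇ; module ≤-Reasoning)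
open import Data.Bool using (Bool; true; false; not; T; _∧_; _∨_)
open import Data.Bool.Properties using (T-∨; T-∧; T-≡; T-not-≡; ¬-not)
open import Data.Fin using (Fin; zero; suc; toℕ; fromℕ<; fromℕ; inject₁; _↑ˡ_; _↑ʳ_; splitAt; #_)
open import Data.Fin.Properties
  using (toℕ<n; toℕ-fromℕ<; toℕ-fromℕ; toℕ-inject₁; toℕ-injective; suc-injective; all?;
         splitAt-↑ˡ; splitAt-↑ʳ; splitAt⁻¹-↑ˡ; splitAt⁻¹-↑ʳ)
  renaming (_≟_ to _≟ᶠ_)
open import Data.Fin.Subset using (Subset; inside; outside; _∩_; _∪_; ∁; ∣_∣; _∈_; _∉_; _⊆_; ⁅_⁆; ⊥; ⊤; Nonempty)
open import Data.Fin.Subset.Properties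
  using (_∈?_; ∈⊤; ∣⊤∣≡n; ∣⁅x⁆∣≡1; ∣p∩q∣≤∣p∣; p⊆q⇒∣p∣≤∣q∣; ⊆-antisym; x∈⁅x⁆; x∈⁅y⁆⇒x≡y; x∈⁅y⁆⇔x≡y;
         x∈p∪q⁻; x∈p∪q⁺; x∈p∩q⁻; x∈p∩q⁺; x∉p⇒x∈∁p; ∩-identityʳ; ∪-identityˡ; ∪-identityʳ)
open import Data.Vec using (_∷_; []; _++_; here; there; tabulate)
open import Data.Vec.Properties using (tabulate-cong; lookup∘tabulate; lookup⇒[]=; []=⇒lookup; zipWith-++; map-++)
import Data.Vec as Vec
open import Data.Product using (Σ; _×_; _,_; proj₁; proj₂)
open import Data.Sum using (_⊎_; inj₁; inj₂; [_,_]′)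
import Data.Sum as Sum
open import Function using (_∘_; Equivalence)
open import Relation.Nullary using (¬_; Dec; yes; no; contradiction)
open import Relation.Nullary.Decidable using (⌊_⌋; ⌊⌋-map′; dec-false; isYes≗does; from-yes; _×-dec_)
open import Relation.Binary.PropositionalEquality

private variable
  m n x y z : ℕ

-- Finite subsets

∣p++q∣≡∣p∣+∣q∣ : (p : Subset m) (q : Subset n) → ∣ p ++ q ∣ ≡ ∣ p ∣ + ∣ q ∣
∣p++q∣≡∣p∣+∣q∣ []            q = refl
∣p++q∣≡∣p∣+∣q∣ (outside ∷ p) q = ∣p++q∣≡∣p∣+∣q∣ p q
∣p++q∣≡∣p∣+∣q∣ (inside  ∷ p) q = cong suc (∣p++q∣≡∣p∣+∣q∣ p q)

∣p∩q∣+∣p∩∁q∣≡∣p∣ : (p q : Subset n) → ∣ p ∩ q ∣ + ∣ p ∩ ∁ q ∣ ≡ ∣ p ∣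
∣p∩q∣+∣p∩∁q∣≡∣p∣ []            []            = refl
∣p∩q∣+∣p∩∁q∣≡∣p∣ (outside ∷ p) (_       ∷ q) = ∣p∩q∣+∣p∩∁q∣≡∣p∣ p q
∣p∩q∣+∣p∩∁q∣≡∣p∣ (inside  ∷ p) (inside  ∷ q) = cong suc (∣p∩q∣+∣p∩∁q∣≡∣p∣ p q)
∣p∩q∣+∣p∩∁q∣≡∣p∣ (inside  ∷ p) (outside ∷ q) =
  trans (+-suc ∣ p ∩ q ∣ _) (cong suc (∣p∩q∣+∣p∩∁q∣≡∣p∣ p q))

∣⁅x⁆∪⁅y⁆∣≡2 : {a b : Fin n} → a ≢ b → ∣ ⁅ a ⁆ ∪ ⁅ b ⁆ ∣ ≡ 2
∣⁅x⁆∪⁅y⁆∣≡2 {a = zero}  {zero}  a≢b = contradiction refl a≢b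
∣⁅x⁆∪⁅y⁆∣≡2 {a = zero}  {suc b} _   = cong suc (trans (cong ∣_∣ (∪-identityˡ ⁅ b ⁆)) (∣⁅x⁆∣≡1 b))
∣⁅x⁆∪⁅y⁆∣≡2 {a = suc a} {zero}  _   = cong suc (trans (cong ∣_∣ (∪-identityʳ ⁅ a ⁆)) (∣⁅x⁆∣≡1 a))
∣⁅x⁆∪⁅y⁆∣≡2 {a = suc a} {suc b} a≢b = ∣⁅x⁆∪⁅y⁆∣≡2 (a≢b ∘ cong suc)

∣p∩⊤∣≡∣p∣ : (p : Subset n) → ∣ p ∩ ⊤ ∣ ≡ ∣ p ∣
∣p∩⊤∣≡∣p∣ p = cong ∣_∣ (∩-identityʳ p)

x∈p⇒⁅x⁆⊆p : {a : Fin n} {p : Subset n} → a ∈ p → ⁅ a ⁆ ⊆ p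
x∈p⇒⁅x⁆⊆p {a = a} {p} a∈p b∈⁅a⁆ = subst (_∈ p) (sym (x∈⁅y⁆⇒x≡y a b∈⁅a⁆)) a∈p

x∈p⇒1≤∣p∣ : {a : Fin n} {p : Subset n} → a ∈ p → 1 ≤ ∣ p ∣
x∈p⇒1≤∣p∣ {a = a} a∈p = subst (_≤ _) (∣⁅x⁆∣≡1 a) (p⊆q⇒∣p∣≤∣q∣ (x∈p⇒⁅x⁆⊆p a∈p))

x≢y∈p⇒2≤∣p∣ : {a b : Fin n} {p : Subset n} → a ∈ p → b ∈ p → a ≢ b → 2 ≤ ∣ p ∣
x≢y∈p⇒2≤∣p∣ {a = a} {b} {p} a∈p b∈p a≢b = subst (_≤ ∣ p ∣) (∣⁅x⁆∪⁅y⁆∣≡2 a≢b) (p⊆q⇒∣p∣≤∣q∣ ⁅a⁆∪⁅b⁆⊆p)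
  where
  ⁅a⁆∪⁅b⁆⊆p : ⁅ a ⁆ ∪ ⁅ b ⁆ ⊆ p
  ⁅a⁆∪⁅b⁆⊆p c∈ = [ x∈p⇒⁅x⁆⊆p a∈p , x∈p⇒⁅x⁆⊆p b∈p ]′ (x∈p∪q⁻ ⁅ a ⁆ ⁅ b ⁆ c∈)

∀∈p⇒n≤∣p∣ : {p : Subset n} → (∀ a → a ∈ p) → n ≤ ∣ p ∣
∀∈p⇒n≤∣p∣ {n} {p} all∈p = subst (_≤ ∣ p ∣) (∣⊤∣≡n n) (p⊆q⇒∣p∣≤∣q∣ {p = ⊤} λ {a} _ → all∈p a)

∣p∣>0⇒Nonempty : (p : Subset n) → 0 < ∣ p ∣ → Nonempty p
∣p∣>0⇒Nonempty (inside  ∷ p) _ = zero , here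
∣p∣>0⇒Nonempty (outside ∷ p) h with ∣p∣>0⇒Nonempty p h
... | a , a∈p = suc a , there a∈p

∈-++⁺ˡ : {a : Fin m} {p : Subset m} (q : Subset n) → a ∈ p → a ↑ˡ n ∈ p ++ q
∈-++⁺ˡ q here        = here
∈-++⁺ˡ q (there a∈p) = there (∈-++⁺ˡ q a∈p)

∈-++⁻ˡ : {a : Fin m} (p : Subset m) (q : Subset n) → a ↑ˡ n ∈ p ++ q → a ∈ p
∈-++⁻ˡ {a = zero}  (_ ∷ p) q here       = here
∈-++⁻ˡ {a = suc a} (_ ∷ p) q (there a∈) = there (∈-++⁻ˡ p q a∈)

∈-++⁺ʳ : {a : Fin n} (p : Subset m) {q : Subset n} → a ∈ q → m ↑ʳ a ∈ p ++ q
∈-++⁺ʳ []      a∈q = a∈q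
∈-++⁺ʳ (_ ∷ p) a∈q = there (∈-++⁺ʳ p a∈q)

tabulate-↑ : (f : Fin (m + n) → Bool) →
             tabulate f ≡ tabulate (λ a → f (a ↑ˡ n)) ++ tabulate (λ b → f (m ↑ʳ b))
tabulate-↑ {zero}      f = refl
tabulate-↑ {suc m} {n} f = cong (f zero ∷_) (tabulate-↑ {m} {n} (f ∘ suc))

tabulate-≟≡⁅⁆ : (a : Fin n) → tabulate (λ b → ⌊ a ≟ᶠ b ⌋) ≡ ⁅ a ⁆
tabulate-≟≡⁅⁆ zero    = cong (true ∷_) (tabulate-false _)
  where
  tabulate-false : ∀ n → tabulate {n = n} (λ _ → false) ≡ ⊥
  tabulate-false zero    = refl
  tabulate-false (suc n) = cong (false ∷_) (tabulate-false n)
tabulate-≟≡⁅⁆ (suc a) =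
  cong (false ∷_) (trans (tabulate-cong (λ b → ⌊⌋-map′ (cong suc) suc-injective (a ≟ᶠ b))) (tabulate-≟≡⁅⁆ a))

≢⇒⌊≟⌋≡false : {a b : Fin n} → a ≢ b → ⌊ a ≟ᶠ b ⌋ ≡ false
≢⇒⌊≟⌋≡false {a = a} {b} a≢b = trans (isYes≗does (a ≟ᶠ b)) (dec-false (a ≟ᶠ b) a≢b)

-- k-tuple total restrained domination

degree : Graph m → Fin m → ℕ
degree G x = ∣ N G x ∣

module _ (G : Graph m) where

  adj⇒∈N : ∀ {x y} → adj G x y ≡ true → y ∈ N G x
  adj⇒∈N {x} {y} e = lookup⇒[]= y (N G x) (trans (lookup∘tabulate (adj G x) y) e)

  ∈N⇒adj : ∀ {x y} → y ∈ N G x → adj G x y ≡ true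
  ∈N⇒adj {x} {y} y∈ = trans (sym (lookup∘tabulate (adj G x) y)) ([]=⇒lookup y∈)

  ∈N⇒≢ : ∀ {x y} → y ∈ N G x → y ≢ x
  ∈N⇒≢ {x} y∈N refl with trans (sym (∈N⇒adj y∈N)) (adj-irr G x)
  ... | ()

  KTRDS-∉⇒2k≤degree : ∀ {k S x} → IsKTRDS G k S → x ∉ S → k + k ≤ degree G x
  KTRDS-∉⇒2k≤degree {k} {S} {x} (dominating , restraining) x∉S =
    subst (k + k ≤_) (∣p∩q∣+∣p∩∁q∣≡∣p∣ (N G x) S) (+-mono-≤ (dominating x) (restraining x x∉S))

  KTRDS-degree<2k⇒∈ : ∀ {k S x} → IsKTRDS G k S → degree G x < k + k → x ∈ S
  KTRDS-degree<2k⇒∈ {S = S} {x} K small with x ∈? S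
  ... | yes x∈S = x∈S
  ... | no  x∉S = contradiction (KTRDS-∉⇒2k≤degree K x∉S) (<⇒≱ small)

  degrees-in? : ∀ k → Dec (∀ x → k ≤ degree G x × degree G x < k + k)
  degrees-in? k = all? λ x → (k ≤? degree G x) ×-dec (degree G x <? k + k)

  γ×t-r≡order : ∀ {k} → (∀ x → k ≤ degree G x × degree G x < k + k) → γ×t-r≡ G k m
  γ×t-r≡order {k} degrees-in =
    (⊤ , ⊤-KTRDS , ∣⊤∣≡n m) , λ S K → ∀∈p⇒n≤∣p∣ λ x → KTRDS-degree<2k⇒∈ K (proj₂ (degrees-in x))
    where
    ⊤-KTRDS : IsKTRDS G k ⊤
    ⊤-KTRDS = (λ x → subst (k ≤_) (sym (∣p∩⊤∣≡∣p∣ (N G x))) (proj₁ (degrees-in x)))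
            , λ _ x∉⊤ → contradiction ∈⊤ x∉⊤

-- Complementary prisms

data Side (m n : ℕ) : Fin (m + n) → Set where
  left  : (a : Fin m) → Side m n (a ↑ˡ n)
  right : (b : Fin n) → Side m n (m ↑ʳ b)

side : ∀ m {n} (x : Fin (m + n)) → Side m n x
side m x with splitAt m x in eq
... | inj₁ a = subst (Side m _) (splitAt⁻¹-↑ˡ eq) (left a)
... | inj₂ b = subst (Side m _) (splitAt⁻¹-↑ʳ eq) (right b)

module _ {n : ℕ} (G : Graph n) where

  private P = complementaryPrism G

  prism-adj-↑ˡ↑ˡ : ∀ a b → adj P (a ↑ˡ n) (b ↑ˡ n) ≡ adj G a b
  prism-adj-↑ˡ↑ˡ a b rewrite splitAt-↑ˡ n a n | splitAt-↑ˡ n b n = refl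

  prism-adj-↑ˡ↑ʳ : ∀ a b → adj P (a ↑ˡ n) (n ↑ʳ b) ≡ ⌊ a ≟ᶠ b ⌋
  prism-adj-↑ˡ↑ʳ a b rewrite splitAt-↑ˡ n a n | splitAt-↑ʳ n n b = refl

  prism-adj-↑ʳ↑ˡ : ∀ a b → adj P (n ↑ʳ a) (b ↑ˡ n) ≡ ⌊ a ≟ᶠ b ⌋
  prism-adj-↑ʳ↑ˡ a b rewrite splitAt-↑ʳ n n a | splitAt-↑ˡ n b n = refl

  prism-adj-↑ʳ↑ʳ : ∀ a b → adj P (n ↑ʳ a) (n ↑ʳ b) ≡ adj (complement G) a b
  prism-adj-↑ʳ↑ʳ a b rewrite splitAt-↑ʳ n n a | splitAt-↑ʳ n n b = refl

  N-prism-↑ˡ : ∀ a → N P (a ↑ˡ n) ≡ N G a ++ ⁅ a ⁆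
  N-prism-↑ˡ a = trans (tabulate-↑ {n} {n} (adj P (a ↑ˡ n))) (cong₂ _++_
    (tabulate-cong (prism-adj-↑ˡ↑ˡ a))
    (trans (tabulate-cong (prism-adj-↑ˡ↑ʳ a)) (tabulate-≟≡⁅⁆ a)))

  N-prism-↑ʳ : ∀ a → N P (n ↑ʳ a) ≡ ⁅ a ⁆ ++ N (complement G) a
  N-prism-↑ʳ a = trans (tabulate-↑ {n} {n} (adj P (n ↑ʳ a))) (cong₂ _++_
    (trans (tabulate-cong (prism-adj-↑ʳ↑ˡ a)) (tabulate-≟≡⁅⁆ a))
    (tabulate-cong (prism-adj-↑ʳ↑ʳ a)))

  degree-prism-↑ˡ : ∀ a → degree P (a ↑ˡ n) ≡ suc (degree G a)
  degree-prism-↑ˡ a = begin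
    ∣ N P (a ↑ˡ n) ∣         ≡⟨ cong ∣_∣ (N-prism-↑ˡ a) ⟩
    ∣ N G a ++ ⁅ a ⁆ ∣       ≡⟨ ∣p++q∣≡∣p∣+∣q∣ (N G a) ⁅ a ⁆ ⟩
    ∣ N G a ∣ + ∣ ⁅ a ⁆ ∣    ≡⟨ cong (∣ N G a ∣ +_) (∣⁅x⁆∣≡1 a) ⟩
    ∣ N G a ∣ + 1            ≡⟨ +-comm ∣ N G a ∣ 1 ⟩
    suc ∣ N G a ∣            ∎
    where open ≡-Reasoning

  ∣N-prism-↑ˡ∩∣ : ∀ a (p q : Subset n) →
                  ∣ N P (a ↑ˡ n) ∩ (p ++ q) ∣ ≡ ∣ N G a ∩ p ∣ + ∣ ⁅ a ⁆ ∩ q ∣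
  ∣N-prism-↑ˡ∩∣ a p q rewrite N-prism-↑ˡ a | zipWith-++ _∧_ (N G a) ⁅ a ⁆ p q =
    ∣p++q∣≡∣p∣+∣q∣ (N G a ∩ p) (⁅ a ⁆ ∩ q)

  ∣N-prism-↑ʳ∩∣ : ∀ a (p q : Subset n) →
                  ∣ N P (n ↑ʳ a) ∩ (p ++ q) ∣ ≡ ∣ ⁅ a ⁆ ∩ p ∣ + ∣ N (complement G) a ∩ q ∣
  ∣N-prism-↑ʳ∩∣ a p q rewrite N-prism-↑ʳ a | zipWith-++ _∧_ ⁅ a ⁆ (N (complement G) a) p q =
    ∣p++q∣≡∣p∣+∣q∣ (⁅ a ⁆ ∩ p) (N (complement G) a ∩ q)

module _ {n : ℕ} (G : Graph (suc n)) (degree≤2 : ∀ a → degree G a ≤ 2) where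

  private
    Ḡ = complement G
    P = complementaryPrism G

  prism-lower-bound : ∀ S → IsKTRDS P 2 S → suc n + 2 ≤ ∣ S ∣
  prism-lower-bound S K@(dominating , _) with Vec.splitAt (suc n) S
  ... | Sᵤ , Sᵥ , refl =
    subst (suc n + 2 ≤_) (sym (∣p++q∣≡∣p∣+∣q∣ Sᵤ Sᵥ)) (+-mono-≤ (∀∈p⇒n≤∣p∣ Sᵤ-full) 2≤∣Sᵥ∣)
    where
    Sᵤ-full : ∀ a → a ∈ Sᵤ
    Sᵤ-full a = ∈-++⁻ˡ Sᵤ Sᵥ (KTRDS-degree<2k⇒∈ P K
      (subst (_< 4) (sym (degree-prism-↑ˡ G a)) (s≤s (s≤s (degree≤2 a)))))

    1≤∣N̄∩Sᵥ∣ : ∀ a → 1 ≤ ∣ N Ḡ a ∩ Sᵥ ∣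
    1≤∣N̄∩Sᵥ∣ a = s≤s⁻¹ (begin
      2                                     ≤⟨ dominating (suc n ↑ʳ a) ⟩
      ∣ N P (suc n ↑ʳ a) ∩ (Sᵤ ++ Sᵥ) ∣      ≡⟨ ∣N-prism-↑ʳ∩∣ G a Sᵤ Sᵥ ⟩
      ∣ ⁅ a ⁆ ∩ Sᵤ ∣ + ∣ N Ḡ a ∩ Sᵥ ∣        ≤⟨ +-monoˡ-≤ _ (∣p∩q∣≤∣p∣ ⁅ a ⁆ Sᵤ) ⟩
      ∣ ⁅ a ⁆ ∣ + ∣ N Ḡ a ∩ Sᵥ ∣             ≡⟨ cong (_+ ∣ N Ḡ a ∩ Sᵥ ∣) (∣⁅x⁆∣≡1 a) ⟩
      1 + ∣ N Ḡ a ∩ Sᵥ ∣                     ∎)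
      where open ≤-Reasoning

    another-in-Sᵥ : ∀ a → Σ (Fin (suc n)) λ b → b ≢ a × b ∈ Sᵥ
    another-in-Sᵥ a with ∣p∣>0⇒Nonempty (N Ḡ a ∩ Sᵥ) (1≤∣N̄∩Sᵥ∣ a)
    ... | b , b∈ with x∈p∩q⁻ (N Ḡ a) Sᵥ b∈
    ...   | b∈N , b∈Sᵥ = b , ∈N⇒≢ Ḡ b∈N , b∈Sᵥ

    2≤∣Sᵥ∣ : 2 ≤ ∣ Sᵥ ∣
    2≤∣Sᵥ∣ with another-in-Sᵥ zero
    ... | b , _ , b∈Sᵥ with another-in-Sᵥ b
    ...   | c , c≢b , c∈Sᵥ = x≢y∈p⇒2≤∣p∣ c∈Sᵥ b∈Sᵥ c≢b

-- Cycles

data CycleStep (n : ℕ) : ℕ → ℕ → Set where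
  next : CycleStep n x (suc x)
  wrap : CycleStep n (n ∸ 1) 0

CycleAdjacent : ℕ → ℕ → ℕ → Set
CycleAdjacent n x y = CycleStep n x y ⊎ CycleStep n y x

-- A copy of the local `step` of `Defs.cycle`: `adj (cycle n)` unfolds definitionally to it.
stepᵇ : ℕ → ℕ → ℕ → Bool
stepᵇ n x y = (y ≡ᵇ suc x) ∨ ((x ≡ᵇ n ∸ 1) ∧ (y ≡ᵇ 0))

T-stepᵇ⇒CycleStep : T (stepᵇ n x y) → CycleStep n x y
T-stepᵇ⇒CycleStep {n} {x} {y} t with Equivalence.to T-∨ t
... | inj₁ y≡1+x = subst (CycleStep n x) (sym (≡ᵇ⇒≡ y (suc x) y≡1+x)) next
... | inj₂ t′ with Equivalence.to T-∧ t′
...   | x≡n-1 , y≡0 = subst₂ (CycleStep n) (sym (≡ᵇ⇒≡ x (n ∸ 1) x≡n-1)) (sym (≡ᵇ⇒≡ y 0 y≡0)) wrap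

CycleStep⇒T-stepᵇ : CycleStep n x y → T (stepᵇ n x y)
CycleStep⇒T-stepᵇ {x = x} next = Equivalence.from T-∨ (inj₁ (≡⇒≡ᵇ (suc x) (suc x) refl))
CycleStep⇒T-stepᵇ {n}     wrap =
  Equivalence.from T-∨ (inj₂ (Equivalence.from T-∧ (≡⇒≡ᵇ (n ∸ 1) (n ∸ 1) refl , _)))

module _ {n : ℕ} where

  cycle-adj⇒ : {a b : Fin n} → adj (cycle n) a b ≡ true → CycleAdjacent n (toℕ a) (toℕ b)
  cycle-adj⇒ e = Sum.map T-stepᵇ⇒CycleStep T-stepᵇ⇒CycleStep
    (Equivalence.to T-∨ (proj₁ (Equivalence.to T-∧ (Equivalence.from T-≡ e))))

  cycle-adj⇐ : {a b : Fin n} → CycleAdjacent n (toℕ a) (toℕ b) → a ≢ b → adj (cycle n) a b ≡ true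
  cycle-adj⇐ ab a≢b = Equivalence.to T-≡ (Equivalence.from T-∧
    ( Equivalence.from T-∨ (Sum.map CycleStep⇒T-stepᵇ CycleStep⇒T-stepᵇ ab)
    , Equivalence.from T-not-≡ (≢⇒⌊≟⌋≡false a≢b)))

  complement-cycle-adj⇐ : {a b : Fin n} → ¬ CycleAdjacent n (toℕ a) (toℕ b) → a ≢ b →
                          adj (complement (cycle n)) a b ≡ true
  complement-cycle-adj⇐ ¬ab a≢b =
    cong₂ (λ u v → not u ∧ not v) (¬-not (¬ab ∘ cycle-adj⇒)) (≢⇒⌊≟⌋≡false a≢b)

far⇒¬CycleAdjacent : 2 + x ≤ y → 2 + y ≤ x + n → ¬ CycleAdjacent n x y
far⇒¬CycleAdjacent 2+x≤y _ (inj₁ next) = 1+n≰n 2+x≤y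
far⇒¬CycleAdjacent ()    _ (inj₁ wrap)
far⇒¬CycleAdjacent 2+x≤y _ (inj₂ next) = 1+n≰n (m+n≤o⇒n≤o 2 2+x≤y)
far⇒¬CycleAdjacent {n = zero}  _ ()    (inj₂ wrap)
far⇒¬CycleAdjacent {n = suc _} _ 2+y≤n (inj₂ wrap) = 1+n≰n 2+y≤n

far⇒complement-cycle-adj : {a b : Fin n} → 2 + toℕ a ≤ toℕ b → 2 + toℕ b ≤ toℕ a + n →
                           adj (complement (cycle n)) a b ≡ true
far⇒complement-cycle-adj 2+a≤b 2+b≤a+n =
  complement-cycle-adj⇐ (far⇒¬CycleAdjacent 2+a≤b 2+b≤a+n) λ { refl → 1+n≰n (m+n≤o⇒n≤o 1 2+a≤b) }

∃successor : (a : Fin n) → Σ (Fin n) λ b → CycleStep n (toℕ a) (toℕ b)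
∃successor {suc m} a with suc (toℕ a) <? suc m
... | yes 1+a<n = fromℕ< 1+a<n , subst (CycleStep (suc m) (toℕ a)) (sym (toℕ-fromℕ< 1+a<n)) next
... | no  1+a≮n = zero , subst (λ x → CycleStep (suc m) x 0) m≡a wrap
  where
  m≡a : m ≡ toℕ a
  m≡a = ≤-antisym (s≤s⁻¹ (≮⇒≥ 1+a≮n)) (s≤s⁻¹ (toℕ<n a))

∃predecessor : (a : Fin n) → Σ (Fin n) λ b → CycleStep n (toℕ b) (toℕ a)
∃predecessor {suc m} zero    = fromℕ m , subst (λ x → CycleStep (suc m) x 0) (sym (toℕ-fromℕ m)) wrap
∃predecessor {suc m} (suc a) =
  inject₁ a , subst (λ x → CycleStep (suc m) x (suc (toℕ a))) (sym (toℕ-inject₁ a)) next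

successor predecessor : Fin n → Fin n
successor   = proj₁ ∘ ∃successor
predecessor = proj₁ ∘ ∃predecessor

successor-step : (a : Fin n) → CycleStep n (toℕ a) (toℕ (successor a))
successor-step = proj₂ ∘ ∃successor

predecessor-step : (a : Fin n) → CycleStep n (toℕ (predecessor a)) (toℕ a)
predecessor-step = proj₂ ∘ ∃predecessor

CycleStep-functional : CycleStep n x y → CycleStep n x z → y < n → z < n → y ≡ z
CycleStep-functional next next _ _ = refl
CycleStep-functional wrap wrap _ _ = refl
CycleStep-functional {suc m} next wrap m<m _ = contradiction m<m (n≮n (suc m))
CycleStep-functional {suc m} wrap next _ m<m = contradiction m<m (n≮n (suc m))

CycleStep-injective : CycleStep n x z → CycleStep n y z → x ≡ y
CycleStep-injective next next = refl
CycleStep-injective wrap wrap = refl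

CycleStep-irreflexive : 2 ≤ n → ¬ CycleStep n x x
CycleStep-irreflexive (s≤s (s≤s _)) ()

CycleStep-asymmetric : 3 ≤ n → CycleStep n x y → ¬ CycleStep n y x
CycleStep-asymmetric (s≤s (s≤s (s≤s _))) next ()
CycleStep-asymmetric (s≤s (s≤s (s≤s _))) wrap ()

module _ {n : ℕ} (3≤n : 3 ≤ n) where

  private C = cycle n

  a≢successor : (a : Fin n) → a ≢ successor a
  a≢successor a a≡s = CycleStep-irreflexive (<⇒≤ 3≤n)
    (subst (CycleStep n (toℕ a) ∘ toℕ) (sym a≡s) (successor-step a))

  a≢predecessor : (a : Fin n) → a ≢ predecessor a
  a≢predecessor a a≡p = CycleStep-irreflexive (<⇒≤ 3≤n)
    (subst (λ b → CycleStep n (toℕ b) (toℕ a)) (sym a≡p) (predecessor-step a))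

  successor≢predecessor : (a : Fin n) → successor a ≢ predecessor a
  successor≢predecessor a s≡p = CycleStep-asymmetric 3≤n (successor-step a)
    (subst (λ b → CycleStep n (toℕ b) (toℕ a)) (sym s≡p) (predecessor-step a))

  N-cycle : (a : Fin n) → N C a ≡ ⁅ successor a ⁆ ∪ ⁅ predecessor a ⁆
  N-cycle a = ⊆-antisym N⊆ ⊆N
    where
    ≡⇒∈⁅⁆ : ∀ {b c} → b ≡ c → b ∈ ⁅ c ⁆
    ≡⇒∈⁅⁆ = Equivalence.from x∈⁅y⁆⇔x≡y

    N⊆ : N C a ⊆ ⁅ successor a ⁆ ∪ ⁅ predecessor a ⁆
    N⊆ {b} b∈N with cycle-adj⇒ (∈N⇒adj C b∈N)
    ... | inj₁ a→b = x∈p∪q⁺ (inj₁ (≡⇒∈⁅⁆ (toℕ-injective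
            (CycleStep-functional a→b (successor-step a) (toℕ<n b) (toℕ<n (successor a))))))
    ... | inj₂ b→a = x∈p∪q⁺ (inj₂ (≡⇒∈⁅⁆ (toℕ-injective (CycleStep-injective b→a (predecessor-step a)))))

    ⊆N : ⁅ successor a ⁆ ∪ ⁅ predecessor a ⁆ ⊆ N C a
    ⊆N {b} b∈ with x∈p∪q⁻ ⁅ successor a ⁆ ⁅ predecessor a ⁆ b∈
    ... | inj₁ b∈⁅s⁆ rewrite x∈⁅y⁆⇒x≡y _ b∈⁅s⁆ =
      adj⇒∈N C (cycle-adj⇐ (inj₁ (successor-step a)) (a≢successor a))
    ... | inj₂ b∈⁅p⁆ rewrite x∈⁅y⁆⇒x≡y _ b∈⁅p⁆ =
      adj⇒∈N C (cycle-adj⇐ (inj₂ (predecessor-step a)) (a≢predecessor a))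

  degree-cycle : (a : Fin n) → degree C a ≡ 2
  degree-cycle a = trans (cong ∣_∣ (N-cycle a)) (∣⁅x⁆∪⁅y⁆∣≡2 (successor≢predecessor a))

-- A 2-tuple total restrained dominating set of size n + 2 for n ≥ 6

module _ (k : ℕ) where

  private
    nₖ = 6 + k
    C̄ = complement (cycle nₖ)
    P = complementaryPrism (cycle nₖ)
    ⊤ₖ = ⊤ {nₖ}

  T₀₃ : Subset nₖ
  T₀₃ = ⁅ zero ⁆ ∪ ⁅ # 3 ⁆

  0∈T₀₃ : zero ∈ T₀₃
  0∈T₀₃ = x∈p∪q⁺ {q = ⁅ # 3 ⁆} (inj₁ (x∈⁅x⁆ zero))

  3∈T₀₃ : # 3 ∈ T₀₃
  3∈T₀₃ = x∈p∪q⁺ {p = ⁅ zero ⁆} (inj₂ (x∈⁅x⁆ (# 3)))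

  ∈T₀₃ : ∀ {a} → a ∈ T₀₃ → toℕ a ≡ 0 ⊎ toℕ a ≡ 3
  ∈T₀₃ a∈ = Sum.map (cong toℕ ∘ x∈⁅y⁆⇒x≡y zero) (cong toℕ ∘ x∈⁅y⁆⇒x≡y (# 3)) (x∈p∪q⁻ ⁅ zero ⁆ ⁅ # 3 ⁆ a∈)

  ∣T₀₃∣≡2 : ∣ T₀₃ ∣ ≡ 2
  ∣T₀₃∣≡2 = ∣⁅x⁆∪⁅y⁆∣≡2 {n = nₖ} {a = zero} {b = # 3} λ ()

  adj⇒∈N̄∩ : ∀ a w {q : Subset nₖ} → adj C̄ a w ≡ true → w ∈ q → w ∈ N C̄ a ∩ q
  adj⇒∈N̄∩ _ _ e w∈q = x∈p∩q⁺ (adj⇒∈N C̄ e , w∈q)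

  adj⇒∈N̄∩∁T₀₃ : ∀ a w → toℕ w ≢ 0 → toℕ w ≢ 3 → adj C̄ a w ≡ true → w ∈ N C̄ a ∩ ∁ T₀₃
  adj⇒∈N̄∩∁T₀₃ a w w≢0 w≢3 e = adj⇒∈N̄∩ a w e (x∉p⇒x∈∁p ([ w≢0 , w≢3 ]′ ∘ ∈T₀₃))

  -- {n-1, 0, 1} and {2, 3, 4} are disjoint, so every vertex is far from 0 or from 3.
  1≤∣N̄∩T₀₃∣ : ∀ a → 1 ≤ ∣ N C̄ a ∩ T₀₃ ∣
  1≤∣N̄∩T₀₃∣ a with toℕ a ≤? 1
  ... | yes a≤1 = x∈p⇒1≤∣p∣ (adj⇒∈N̄∩ a (# 3) (far⇒complement-cycle-adj (+-monoʳ-≤ 2 a≤1) 5≤a+n) 3∈T₀₃)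
    where
    5≤a+n : 5 ≤ toℕ a + nₖ
    5≤a+n = ≤-trans (m≤m+n 5 (suc k)) (m≤n+m nₖ (toℕ a))
  ... | no a≰1 with 2 + toℕ a ≤? nₖ
  ...   | yes 2+a≤n = x∈p⇒1≤∣p∣
          (adj⇒∈N̄∩ a zero (trans (adj-sym C̄ a zero) (far⇒complement-cycle-adj (≰⇒> a≰1) 2+a≤n)) 0∈T₀₃)
  ...   | no 2+a≰n = x∈p⇒1≤∣p∣
          (adj⇒∈N̄∩ a (# 3) (trans (adj-sym C̄ a (# 3)) (far⇒complement-cycle-adj 5≤a 2+a≤3+n)) 3∈T₀₃)
    where
    5≤a : 5 ≤ toℕ a
    5≤a = ≤-trans (m≤m+n 5 k) (s≤s⁻¹ (s≤s⁻¹ (≰⇒> 2+a≰n)))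
    2+a≤3+n : 2 + toℕ a ≤ 3 + nₖ
    2+a≤3+n = ≤-trans (s≤s (toℕ<n a)) (m≤n+m (suc nₖ) 2)

  -- A vertex a ∉ {0, 3} is far from both 4 and 5 if a ≤ 2, and from both 1 and 2 otherwise.
  2≤∣N̄∩∁T₀₃∣ : ∀ a → a ∉ T₀₃ → 2 ≤ ∣ N C̄ a ∩ ∁ T₀₃ ∣
  2≤∣N̄∩∁T₀₃∣ a a∉T with toℕ a ≤? 2
  ... | yes a≤2 = x≢y∈p⇒2≤∣p∣
          (adj⇒∈N̄∩∁T₀₃ a (# 4) (λ ()) (λ ()) (far⇒complement-cycle-adj (+-monoʳ-≤ 2 a≤2) 6≤a+n))
          (adj⇒∈N̄∩∁T₀₃ a (# 5) (λ ()) (λ ()) (far⇒complement-cycle-adj (+-monoʳ-≤ 2 (m≤n⇒m≤1+n a≤2)) 7≤a+n))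
          (λ ())
    where
    6≤a+n : 6 ≤ toℕ a + nₖ
    6≤a+n = ≤-trans (m≤m+n 6 k) (m≤n+m nₖ (toℕ a))
    7≤a+n : 7 ≤ toℕ a + nₖ
    7≤a+n = +-mono-≤ (n≢0⇒n>0 λ a≡0 → a∉T (subst (_∈ T₀₃) (sym (toℕ-injective a≡0)) 0∈T₀₃)) (m≤m+n 6 k)
  ... | no a≰2 = x≢y∈p⇒2≤∣p∣
          (adj⇒∈N̄∩∁T₀₃ a (# 1) (λ ()) (λ ())
            (trans (adj-sym C̄ a (# 1)) (far⇒complement-cycle-adj (≰⇒> a≰2) (s≤s (toℕ<n a)))))
          (adj⇒∈N̄∩∁T₀₃ a (# 2) (λ ()) (λ ())
            (trans (adj-sym C̄ a (# 2)) (far⇒complement-cycle-adj 4≤a (+-monoʳ-≤ 2 (<⇒≤ (toℕ<n a))))))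
          (λ ())
    where
    4≤a : 4 ≤ toℕ a
    4≤a = ≤∧≢⇒< (≰⇒> a≰2) λ 3≡a → a∉T (subst (_∈ T₀₃) (toℕ-injective 3≡a) 3∈T₀₃)

  S₀₃ : Subset (nₖ + nₖ)
  S₀₃ = ⊤ₖ ++ T₀₃

  ∣S₀₃∣≡n+2 : ∣ S₀₃ ∣ ≡ nₖ + 2
  ∣S₀₃∣≡n+2 = trans (∣p++q∣≡∣p∣+∣q∣ ⊤ₖ T₀₃) (cong₂ _+_ (∣⊤∣≡n nₖ) ∣T₀₃∣≡2)

  S₀₃-KTRDS : IsKTRDS P 2 S₀₃
  S₀₃-KTRDS = dominating , restraining
    where
    open ≤-Reasoning

    dominating : ∀ x → 2 ≤ ∣ N P x ∩ S₀₃ ∣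
    dominating x with side nₖ x
    ... | left a = begin
      2                                         ≡⟨ degree-cycle (m≤m+n 3 (3 + k)) a ⟨
      ∣ N (cycle nₖ) a ∣                         ≡⟨ ∣p∩⊤∣≡∣p∣ (N (cycle nₖ) a) ⟨
      ∣ N (cycle nₖ) a ∩ ⊤ ∣                     ≤⟨ m≤m+n _ _ ⟩
      ∣ N (cycle nₖ) a ∩ ⊤ ∣ + ∣ ⁅ a ⁆ ∩ T₀₃ ∣    ≡⟨ ∣N-prism-↑ˡ∩∣ (cycle nₖ) a ⊤ T₀₃ ⟨
      ∣ N P (a ↑ˡ nₖ) ∩ S₀₃ ∣                    ∎
    ... | right a = begin
      1 + 1                                     ≤⟨ +-monoʳ-≤ 1 (1≤∣N̄∩T₀₃∣ a) ⟩
      1 + ∣ N C̄ a ∩ T₀₃ ∣                        ≡⟨ cong (_+ ∣ N C̄ a ∩ T₀₃ ∣) (trans (∣p∩⊤∣≡∣p∣ ⁅ a ⁆) (∣⁅x⁆∣≡1 a)) ⟨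
      ∣ ⁅ a ⁆ ∩ ⊤ ∣ + ∣ N C̄ a ∩ T₀₃ ∣             ≡⟨ ∣N-prism-↑ʳ∩∣ (cycle nₖ) a ⊤ T₀₃ ⟨
      ∣ N P (nₖ ↑ʳ a) ∩ S₀₃ ∣                    ∎

    restraining : ∀ x → x ∉ S₀₃ → 2 ≤ ∣ N P x ∩ ∁ S₀₃ ∣
    restraining x x∉S with side nₖ x
    ... | left a = contradiction (∈-++⁺ˡ {p = ⊤} T₀₃ ∈⊤) x∉S
    ... | right a = begin
      2                                         ≤⟨ 2≤∣N̄∩∁T₀₃∣ a (x∉S ∘ ∈-++⁺ʳ ⊤) ⟩
      ∣ N C̄ a ∩ ∁ T₀₃ ∣                          ≤⟨ m≤n+m _ _ ⟩
      ∣ ⁅ a ⁆ ∩ ∁ ⊤ ∣ + ∣ N C̄ a ∩ ∁ T₀₃ ∣         ≡⟨ ∣N-prism-↑ʳ∩∣ (cycle nₖ) a (∁ ⊤) (∁ T₀₃) ⟨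
      ∣ N P (nₖ ↑ʳ a) ∩ (∁ ⊤ₖ ++ ∁ T₀₃) ∣         ≡⟨ cong (λ q → ∣ N P (nₖ ↑ʳ a) ∩ q ∣) (map-++ not ⊤ₖ T₀₃) ⟨
      ∣ N P (nₖ ↑ʳ a) ∩ ∁ S₀₃ ∣                  ∎

corollary5p3 : (n : ℕ) → 4 ≤ n →
    ((n ≡ 4 ⊎ n ≡ 5) → γ×t-r≡ (complementaryPrism (cycle n)) 2 (2 * n)) ×
    (6 ≤ n → γ×t-r≡ (complementaryPrism (cycle n)) 2 (n + 2))
corollary5p3 n _ = small , large
  where
  P : (m : ℕ) → Graph (m + m)
  P m = complementaryPrism (cycle m)

  small : n ≡ 4 ⊎ n ≡ 5 → γ×t-r≡ (P n) 2 (2 * n)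
  small (inj₁ refl) = γ×t-r≡order (P 4) (from-yes (degrees-in? (P 4) 2))
  small (inj₂ refl) = γ×t-r≡order (P 5) (from-yes (degrees-in? (P 5) 2))

  large : 6 ≤ n → γ×t-r≡ (P n) 2 (n + 2)
  large (s≤s (s≤s (s≤s (s≤s (s≤s (s≤s {n = k} _)))))) =
      (S₀₃ k , S₀₃-KTRDS k , ∣S₀₃∣≡n+2 k)
    , prism-lower-bound (cycle (6 + k)) (≤-reflexive ∘ degree-cycle (m≤m+n 3 (3 + k)))
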